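{- Let $0<q<1$ and $\lambda\in\mathbb{C}$ with $\lambda\neq 1$. For all integers $n,r\geq 0$, $$H_{n,q}(x\mid\lambda)=\frac{1}{(1-\lambda)^r}\sum_{k=0}^{n}\left\{\sum_{m=0}^{n-k}\sum_{l=0}^{r}\sum_{i_1+\cdots+i_l=m}\binom{r}{l}(-\lambda)^{r-l}\binom{m}{i_1,\ldots,i_l}_q\binom{m+k}{m}_q\binom{n}{m+k}_q H_{n-m-k,q}(\lambda)\right\}H^{(r)}_{k,q}(x\mid\lambda),$$ where the innermost sum runs over $l$-tuples of nonnegative integers with sum $m$ (for $l=0$ it consists of the single empty tuple, with multinomial coefficient $1$, if $m=0$, and is empty if $m>0$).
   Context: For a number $x$, $[x]_q=\frac{1-q^{x}}{1-q}$; $[0]_q!=1$ and $[n]_q!=[n]_q\cdots[1]_q$; $\binom{n}{k}_q=\frac{[n]_q!}{[k]_q![n-k]_q!}$ and $\binom{m}{i_1,\ldots,i_l}_q=\frac{[m]_q!}{[i_1]_q!\cdots[i_l]_q!}$. The $q$-exponential is $e_q(z)=\sum_{n\ge0}\frac{z^n}{[n]_q!}$. For an integer $s\ge0$, define $H^{(s)}_{n,q}(x\mid\lambda)$ by the formal power series identity $\left(\frac{1-\lambda}{e_q(t)-\lambda}\right)^s e_q(xt)=\sum_{n\ge0}H^{(s)}_{n,q}(x\mid\lambda)\frac{t^n}{[n]_q!}$; write $H_{n,q}(x\mid\lambda)=H^{(1)}_{n,q}(x\mid\lambda)$ and $H_{n,q}(\lambda)=H_{n,q}(0\mid\lambda)$.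 -}

module Defs where

open import Level using (_⊔_)
open import Data.Nat as ℕ using (ℕ; zero; suc; _∸_)
open import Data.Nat.Combinatorics using (_C_)
open import Data.List using (List; []; _∷_; map; zipWith; concatMap; foldr; upTo)
open import Relation.Nullary using (¬_)
open import Algebra.Bundles using (CommutativeRing)
import Relation.Binary.Reasoning.Setoid as SetoidReasoning

record Field c ℓ : Set (Level.suc (c ⊔ ℓ)) where
  field
    commutativeRing : CommutativeRing c ℓ
  open CommutativeRing commutativeRing public
  field
    1≉0     : ¬ (1# ≈ 0#)
    inv     : (x : Carrier) → ¬ (x ≈ 0#) → Carrier
    inv-law : (x : Carrier) (p : ¬ (x ≈ 0#)) → x * inv x p ≈ 1#

module _ {c ℓ} (F : Field c ℓ) where
  open Field F

  pow : Carrier → ℕ → Carrier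
  pow a zero    = 1#
  pow a (suc n) = a * pow a n

  fromℕ : ℕ → Carrier
  fromℕ zero    = 0#
  fromℕ (suc n) = 1# + fromℕ n

  sumTo : ℕ → (ℕ → Carrier) → Carrier
  sumTo zero    f = f 0
  sumTo (suc n) f = sumTo n f + f (suc n)

  sumList : List Carrier → Carrier
  sumList = foldr _+_ 0#

  prodList : List Carrier → Carrier
  prodList = foldr _*_ 1#

  -- weak compositions: all l-tuples (as lists) of naturals with sum m
  comps : ℕ → ℕ → List (List ℕ)
  comps zero    zero    = [] ∷ []
  comps zero    (suc m) = []
  comps (suc l) m       = concatMap (λ i → map (i ∷_) (comps l (m ∸ i))) (upTo (suc m))

  1-≉0 : (a : Carrier) → ¬ (a ≈ 1#) → ¬ ((1# - a) ≈ 0#)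
  1-≉0 a a≉1 e = a≉1 (begin
      a                 ≈⟨ +-identityˡ a ⟨
      0# + a            ≈⟨ +-congʳ e ⟨
      (1# - a) + a      ≈⟨ +-assoc 1# (- a) a ⟩
      1# + (- a + a)    ≈⟨ +-congˡ (-‿inverseˡ a) ⟩
      1# + 0#           ≈⟨ +-identityʳ 1# ⟩
      1# ∎)
    where open SetoidReasoning setoid

  module _ (q : Carrier) (q≉1 : ¬ (q ≈ 1#)) where

    qint : ℕ → Carrier
    qint n = (1# - pow q n) * inv (1# - q) (1-≉0 q q≉1)

    qfact : ℕ → Carrier
    qfact zero    = 1#
    qfact (suc n) = qint (suc n) * qfact n

    module _ (qnz : (n : ℕ) → ¬ (qint (suc n) ≈ 0#)) where

      -- 1/[n]_q!  (= coefficient of z^n in e_q(z))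
      qfactInv : ℕ → Carrier
      qfactInv zero    = 1#
      qfactInv (suc n) = inv (qint (suc n)) (qnz n) * qfactInv n

      qbinom : ℕ → ℕ → Carrier
      qbinom n k = qfact n * qfactInv k * qfactInv (n ∸ k)

      qmultinom : ℕ → List ℕ → Carrier
      qmultinom m is = qfact m * prodList (map qfactInv is)

      Series : Set c
      Series = ℕ → Carrier

      oneSeries : Series
      oneSeries zero    = 1#
      oneSeries (suc n) = 0#

      _⊛_ : Series → Series → Series
      (f ⊛ g) n = sumTo n (λ k → f k * g (n ∸ k))

      seriesPow : Series → ℕ → Series
      seriesPow f zero    = oneSeries
      seriesPow f (suc s) = f ⊛ seriesPow f s

      -- e_q(x t)
      eqSeries : Carrier → Series
      eqSeries x n = pow x n * qfactInv n

      module _ (la : Carrier) (la≉1 : ¬ (la ≈ 1#)) where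

        c₀ : Carrier
        c₀ = inv (1# - la) (1-≉0 la la≉1)

        -- coefficients of 1/(e_q(t) - λ), listed as [b_n, …, b_0]
        invCoeffs : ℕ → List Carrier
        invCoeffs zero    = c₀ ∷ []
        invCoeffs (suc n) =
          (- (c₀ * sumList (zipWith _*_ (map (λ j → qfactInv (suc j)) (upTo (suc n))) (invCoeffs n))))
          ∷ invCoeffs n

        headOr0 : List Carrier → Carrier
        headOr0 []      = 0#
        headOr0 (b ∷ _) = b

        invSeries : Series
        invSeries n = headOr0 (invCoeffs n)

        kernel : Series
        kernel n = (1# - la) * invSeries n

        H : ℕ → Carrier → ℕ → Carrier
        H s x n = qfact n * (seriesPow kernel s ⊛ eqSeries x) n

{-# OPTIONS --safe #-}
-- With K = (1 - λ)/(e_q(t) - λ) and D = e_q(t) - λ we have K D = 1 - λ, hence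
--   K e_q(xt) = (1 - λ)^(-r) (K^r e_q(xt)) (D^r K).
-- The coefficients of K^r e_q(xt) are H^(r)_k(x|λ)/[k]_q! and those of K are H_j(λ)/[j]_q!,
-- while D^r = Σ_l C(r,l) (-λ)^(r-l) e_q(t)^l and e_q(t)^l expands over weak compositions.
-- Comparing coefficients of t^n, the q-multinomial and q-binomial coefficients of the theorem
-- telescope: together with H_{n-m-k}(λ) they leave [n]_q!/[k]_q! times the coefficients of
-- D^r and K.
module Submission where

open import Defs
open import Data.Nat using (ℕ; zero; suc; _∸_; _≤_; z≤n) renaming (_+_ to _+ℕ_)
import Data.Nat.Properties as ℕ
open import Data.Nat.Combinatorics using (_C_)
open import Data.List using (List; []; _∷_; map; zipWith; concatMap; upTo; downFrom; applyUpTo; _++_)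
import Data.List.Properties as List
open import Data.Fin using (toℕ)
open import Data.Product using (_,_)
open import Function using (_∘_)
open import Relation.Binary.PropositionalEquality as ≡ using (_≡_)
open import Relation.Nullary using (¬_)
open import Algebra.Bundles using (CommutativeSemiring)
open import Algebra.Structures using (IsCommutativeMonoid)
open import Algebra.Structures.Biased using (IsCommutativeSemiringˡ)
import Algebra.Properties.CommutativeSemiring.Binomial
open import Relation.Binary.Structures using (IsEquivalence)

module FiniteSums {c ℓ} (F : Field c ℓ) where
  open Field F
  open import Relation.Binary.Reasoning.Setoid setoid
  open import Algebra.Properties.CommutativeSemigroup +-commutativeSemigroup using (interchange)

  Σ≤ : ℕ → (ℕ → Carrier) → Carrier
  Σ≤ = sumTo F

  syntax Σ≤ n (λ i → e) = Σ[ i ≤ n ] e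

  Σ-cong-≤ : ∀ n {f g : ℕ → Carrier} → (∀ i → i ≤ n → f i ≈ g i) → Σ≤ n f ≈ Σ≤ n g
  Σ-cong-≤ zero    f≈g = f≈g 0 z≤n
  Σ-cong-≤ (suc n) f≈g =
    +-cong (Σ-cong-≤ n (λ i i≤n → f≈g i (ℕ.m≤n⇒m≤1+n i≤n))) (f≈g (suc n) ℕ.≤-refl)

  Σ-cong : ∀ n {f g : ℕ → Carrier} → (∀ i → f i ≈ g i) → Σ≤ n f ≈ Σ≤ n g
  Σ-cong n f≈g = Σ-cong-≤ n (λ i _ → f≈g i)

  Σ-suc : ∀ n (f : ℕ → Carrier) → Σ≤ (suc n) f ≈ f 0 + Σ[ i ≤ n ] f (suc i)
  Σ-suc zero    f = refl
  Σ-suc (suc n) f = trans (+-congʳ (Σ-suc n f)) (+-assoc _ _ _)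

  Σ-distrib-+ : ∀ n (f g : ℕ → Carrier) → Σ[ i ≤ n ] (f i + g i) ≈ Σ≤ n f + Σ≤ n g
  Σ-distrib-+ zero    f g = refl
  Σ-distrib-+ (suc n) f g = trans (+-congʳ (Σ-distrib-+ n f g)) (interchange _ _ _ _)

  Σ-distribˡ : ∀ n a (f : ℕ → Carrier) → a * Σ≤ n f ≈ Σ[ i ≤ n ] (a * f i)
  Σ-distribˡ zero    a f = refl
  Σ-distribˡ (suc n) a f = trans (distribˡ _ _ _) (+-congʳ (Σ-distribˡ n a f))

  Σ-distribʳ : ∀ n a (f : ℕ → Carrier) → Σ≤ n f * a ≈ Σ[ i ≤ n ] (f i * a)
  Σ-distribʳ zero    a f = refl
  Σ-distribʳ (suc n) a f = trans (distribʳ _ _ _) (+-congʳ (Σ-distribʳ n a f))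

  Σ-zero : ∀ n → Σ[ i ≤ n ] 0# ≈ 0#
  Σ-zero zero    = refl
  Σ-zero (suc n) = trans (+-identityʳ _) (Σ-zero n)

  Σ-reverse : ∀ n (f : ℕ → Carrier) → Σ≤ n f ≈ Σ[ i ≤ n ] f (n ∸ i)
  Σ-reverse zero    f = refl
  Σ-reverse (suc n) f = begin
    Σ≤ n f + f (suc n)                ≈⟨ +-comm _ _ ⟩
    f (suc n) + Σ≤ n f                ≈⟨ +-congˡ (Σ-reverse n f) ⟩
    f (suc n) + Σ[ i ≤ n ] f (n ∸ i)  ≈⟨ Σ-suc n (λ i → f (suc n ∸ i)) ⟨
    Σ[ i ≤ suc n ] f (suc n ∸ i)      ∎

  Σ-triangle : ∀ n (G : ℕ → ℕ → Carrier) →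
    Σ[ i ≤ n ] Σ[ k ≤ i ] G k i ≈ Σ[ k ≤ n ] Σ[ j ≤ n ∸ k ] G k (k +ℕ j)
  Σ-triangle zero    G = refl
  Σ-triangle (suc n) G = begin
    Σ[ i ≤ n ] Σ[ k ≤ i ] G k i + (Σ[ k ≤ n ] G k (suc n) + G (suc n) (suc n))
      ≈⟨ +-congʳ (Σ-triangle n G) ⟩
    Σ[ k ≤ n ] Σ[ j ≤ n ∸ k ] G k (k +ℕ j) + (Σ[ k ≤ n ] G k (suc n) + G (suc n) (suc n))
      ≈⟨ +-assoc _ _ _ ⟨
    (Σ[ k ≤ n ] Σ[ j ≤ n ∸ k ] G k (k +ℕ j) + Σ[ k ≤ n ] G k (suc n)) + G (suc n) (suc n)
      ≈⟨ +-cong (Σ-distrib-+ n _ _) (reflexive (≡.cong (G (suc n)) (ℕ.+-identityʳ (suc n)))) ⟨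
    Σ[ k ≤ n ] (Σ[ j ≤ n ∸ k ] G k (k +ℕ j) + G k (suc n)) + G (suc n) (suc n +ℕ 0)
      ≈⟨ +-cong (Σ-cong-≤ n (λ k k≤n → sym (extend-row k k≤n)))
                (reflexive (≡.cong (λ t → Σ[ j ≤ t ] G (suc n) (suc n +ℕ j))
                                   (≡.sym (ℕ.n∸n≡0 n)))) ⟩
    Σ[ k ≤ n ] Σ[ j ≤ suc n ∸ k ] G k (k +ℕ j) + Σ[ j ≤ suc n ∸ suc n ] G (suc n) (suc n +ℕ j)
      ∎
    where
      extend-row : ∀ k → k ≤ n →
        Σ[ j ≤ suc n ∸ k ] G k (k +ℕ j) ≈ Σ[ j ≤ n ∸ k ] G k (k +ℕ j) + G k (suc n)
      extend-row k k≤n rewrite ℕ.+-∸-assoc 1 k≤n =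
        +-congˡ (reflexive (≡.cong (G k)
          (≡.trans (ℕ.+-suc k (n ∸ k)) (≡.cong suc (ℕ.m+[n∸m]≡n k≤n)))))

  sumList-++ : ∀ xs ys → sumList F (xs ++ ys) ≈ sumList F xs + sumList F ys
  sumList-++ []       ys = sym (+-identityˡ _)
  sumList-++ (x ∷ xs) ys = trans (+-congˡ (sumList-++ xs ys)) (sym (+-assoc _ _ _))

  sumList-cong : ∀ {A : Set} {f g : A → Carrier} (xs : List A) →
    (∀ a → f a ≈ g a) → sumList F (map f xs) ≈ sumList F (map g xs)
  sumList-cong []       f≈g = refl
  sumList-cong (x ∷ xs) f≈g = +-cong (f≈g x) (sumList-cong xs f≈g)

  sumList-distribˡ : ∀ {A : Set} a (f : A → Carrier) (xs : List A) →
    a * sumList F (map f xs) ≈ sumList F (map (λ x → a * f x) xs)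
  sumList-distribˡ a f []       = zeroʳ _
  sumList-distribˡ a f (x ∷ xs) = trans (distribˡ _ _ _) (+-congˡ (sumList-distribˡ a f xs))

  sumList-distribʳ : ∀ {A : Set} a (f : A → Carrier) (xs : List A) →
    sumList F (map f xs) * a ≈ sumList F (map (λ x → f x * a) xs)
  sumList-distribʳ a f []       = zeroˡ _
  sumList-distribʳ a f (x ∷ xs) = trans (distribʳ _ _ _) (+-congˡ (sumList-distribʳ a f xs))

  sumList-concatMap : ∀ {A B : Set} (g : B → Carrier) (h : A → List B) (xs : List A) →
    sumList F (map g (concatMap h xs)) ≈ sumList F (map (λ a → sumList F (map g (h a))) xs)
  sumList-concatMap g h []       = refl
  sumList-concatMap g h (x ∷ xs) = begin
    sumList F (map g (h x ++ concatMap h xs))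
      ≡⟨ ≡.cong (sumList F) (List.map-++ g (h x) (concatMap h xs)) ⟩
    sumList F (map g (h x) ++ map g (concatMap h xs))
      ≈⟨ sumList-++ (map g (h x)) (map g (concatMap h xs)) ⟩
    sumList F (map g (h x)) + sumList F (map g (concatMap h xs))
      ≈⟨ +-congˡ (sumList-concatMap g h xs) ⟩
    sumList F (map (λ a → sumList F (map g (h a))) (x ∷ xs)) ∎

  sumList-applyUpTo : ∀ m (g : ℕ → ℕ) (f : ℕ → Carrier) →
    sumList F (map f (applyUpTo g (suc m))) ≈ Σ[ i ≤ m ] f (g i)
  sumList-applyUpTo zero    g f = +-identityʳ _
  sumList-applyUpTo (suc m) g f =
    trans (+-congˡ (sumList-applyUpTo m (g ∘ suc) f)) (sym (Σ-suc m _))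

  sumList-zipWith-downFrom : ∀ m (φ ψ : ℕ → Carrier) →
    sumList F (zipWith _*_ (applyUpTo φ (suc m)) (map ψ (downFrom (suc m))))
      ≈ Σ[ j ≤ m ] (φ j * ψ (m ∸ j))
  sumList-zipWith-downFrom zero    φ ψ = +-identityʳ _
  sumList-zipWith-downFrom (suc m) φ ψ =
    trans (+-congˡ (sumList-zipWith-downFrom m (φ ∘ suc) ψ)) (sym (Σ-suc m _))

module PowerSeries {c ℓ} (F : Field c ℓ) where
  open Field F
  open FiniteSums F
  open import Relation.Binary.Reasoning.Setoid setoid

  FormalSeries : Set c
  FormalSeries = ℕ → Carrier

  infix 4 _≋_
  _≋_ : FormalSeries → FormalSeries → Set ℓ
  f ≋ g = ∀ n → f n ≈ g n

  infixl 6 _⊕_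
  _⊕_ : FormalSeries → FormalSeries → FormalSeries
  (f ⊕ g) n = f n + g n

  infixl 7 _⋆_
  _⋆_ : FormalSeries → FormalSeries → FormalSeries
  (f ⋆ g) n = Σ[ k ≤ n ] (f k * g (n ∸ k))

  𝟘 : FormalSeries
  𝟘 _ = 0#

  𝟙 : FormalSeries
  𝟙 zero    = 1#
  𝟙 (suc _) = 0#

  const : Carrier → FormalSeries
  const a n = a * 𝟙 n

  ⋆-cong : ∀ {f f′ g g′} → f ≋ f′ → g ≋ g′ → f ⋆ g ≋ f′ ⋆ g′
  ⋆-cong f≋f′ g≋g′ n = Σ-cong n (λ k → *-cong (f≋f′ k) (g≋g′ (n ∸ k)))

  ⋆-congʳ : ∀ g {f f′} → f ≋ f′ → f ⋆ g ≋ f′ ⋆ g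
  ⋆-congʳ g f≋f′ = ⋆-cong {g = g} f≋f′ (λ _ → refl)

  ⋆-comm : ∀ f g → f ⋆ g ≋ g ⋆ f
  ⋆-comm f g n = begin
    Σ[ k ≤ n ] (f k * g (n ∸ k))
      ≈⟨ Σ-reverse n _ ⟩
    Σ[ k ≤ n ] (f (n ∸ k) * g (n ∸ (n ∸ k)))
      ≈⟨ Σ-cong-≤ n (λ k k≤n →
           trans (*-comm _ _) (*-congʳ (reflexive (≡.cong g (ℕ.m∸[m∸n]≡n k≤n))))) ⟩
    Σ[ k ≤ n ] (g k * f (n ∸ k)) ∎

  ⋆-assoc : ∀ f g h → (f ⋆ g) ⋆ h ≋ f ⋆ (g ⋆ h)
  ⋆-assoc f g h n = begin
    Σ[ i ≤ n ] (Σ[ k ≤ i ] (f k * g (i ∸ k)) * h (n ∸ i))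
      ≈⟨ Σ-cong n (λ i → Σ-distribʳ i _ _) ⟩
    Σ[ i ≤ n ] Σ[ k ≤ i ] ((f k * g (i ∸ k)) * h (n ∸ i))
      ≈⟨ Σ-triangle n (λ k i → (f k * g (i ∸ k)) * h (n ∸ i)) ⟩
    Σ[ k ≤ n ] Σ[ j ≤ n ∸ k ] ((f k * g (k +ℕ j ∸ k)) * h (n ∸ (k +ℕ j)))
      ≈⟨ Σ-cong n (λ k → Σ-cong (n ∸ k) (λ j → trans (*-assoc _ _ _)
           (*-congˡ (*-cong (reflexive (≡.cong g (ℕ.m+n∸m≡n k j)))
                            (reflexive (≡.cong h (≡.sym (ℕ.∸-+-assoc n k j)))))))) ⟩
    Σ[ k ≤ n ] Σ[ j ≤ n ∸ k ] (f k * (g j * h (n ∸ k ∸ j)))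
      ≈⟨ Σ-cong n (λ k → Σ-distribˡ (n ∸ k) _ _) ⟨
    Σ[ k ≤ n ] (f k * Σ[ j ≤ n ∸ k ] (g j * h (n ∸ k ∸ j))) ∎

  ⋆-identityˡ : ∀ f → 𝟙 ⋆ f ≋ f
  ⋆-identityˡ f zero    = *-identityˡ _
  ⋆-identityˡ f (suc n) = begin
    Σ[ k ≤ suc n ] (𝟙 k * f (suc n ∸ k))
      ≈⟨ Σ-suc n _ ⟩
    1# * f (suc n) + Σ[ k ≤ n ] (0# * f (n ∸ k))
      ≈⟨ +-cong (*-identityˡ _) (trans (Σ-cong n (λ _ → zeroˡ _)) (Σ-zero n)) ⟩
    f (suc n) + 0#
      ≈⟨ +-identityʳ _ ⟩
    f (suc n) ∎

  ⋆-identityʳ : ∀ f → f ⋆ 𝟙 ≋ f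
  ⋆-identityʳ f n = trans (⋆-comm f 𝟙 n) (⋆-identityˡ f n)

  ⋆-distribʳ : ∀ h f g → (f ⊕ g) ⋆ h ≋ f ⋆ h ⊕ g ⋆ h
  ⋆-distribʳ h f g n = trans (Σ-cong n (λ _ → distribʳ _ _ _)) (Σ-distrib-+ n _ _)

  ⋆-zeroˡ : ∀ f → 𝟘 ⋆ f ≋ 𝟘
  ⋆-zeroˡ f n = trans (Σ-cong n (λ _ → zeroˡ _)) (Σ-zero n)

  ≋-isEquivalence : IsEquivalence _≋_
  ≋-isEquivalence = record
    { refl  = λ _ → refl
    ; sym   = λ f≋g n → sym (f≋g n)
    ; trans = λ f≋g g≋h n → trans (f≋g n) (g≋h n)
    }

  ⊕-isCommutativeMonoid : IsCommutativeMonoid _≋_ _⊕_ 𝟘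
  ⊕-isCommutativeMonoid = record
    { isMonoid = record
      { isSemigroup = record
        { isMagma = record { isEquivalence = ≋-isEquivalence ; ∙-cong = λ p q n → +-cong (p n) (q n) }
        ; assoc   = λ _ _ _ _ → +-assoc _ _ _
        }
      ; identity = (λ _ _ → +-identityˡ _) , (λ _ _ → +-identityʳ _)
      }
    ; comm = λ _ _ _ → +-comm _ _
    }

  ⋆-isCommutativeMonoid : IsCommutativeMonoid _≋_ _⋆_ 𝟙
  ⋆-isCommutativeMonoid = record
    { isMonoid = record
      { isSemigroup = record
        { isMagma = record { isEquivalence = ≋-isEquivalence ; ∙-cong = ⋆-cong }
        ; assoc   = ⋆-assoc
        }
      ; identity = ⋆-identityˡ , ⋆-identityʳ
      }
    ; comm = ⋆-comm
    }

  seriesSemiring : CommutativeSemiring c ℓ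
  seriesSemiring = record
    { isCommutativeSemiring = IsCommutativeSemiringˡ.isCommutativeSemiring (record
      { +-isCommutativeMonoid = ⊕-isCommutativeMonoid
      ; *-isCommutativeMonoid = ⋆-isCommutativeMonoid
      ; distribʳ              = ⋆-distribʳ
      ; zeroˡ                 = ⋆-zeroˡ
      })
    }

  open import Algebra.Definitions.RawSemiring (CommutativeSemiring.rawSemiring seriesSemiring)
    public using (_^_; _×_; sum)
  open import Algebra.Properties.CommutativeSemigroup (CommutativeSemiring.*-commutativeSemigroup seriesSemiring)
    public using () renaming (interchange to ⋆-interchange)
  open import Algebra.Properties.CommutativeSemiring.Exp seriesSemiring public using (^-distrib-*)
  open import Algebra.Properties.Semiring.Exp (CommutativeSemiring.semiring seriesSemiring) public using (^-congˡ)

  const-⋆ : ∀ a g n → (const a ⋆ g) n ≈ a * g n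
  const-⋆ a g n = begin
    Σ[ k ≤ n ] ((a * 𝟙 k) * g (n ∸ k)) ≈⟨ Σ-cong n (λ _ → *-assoc _ _ _) ⟩
    Σ[ k ≤ n ] (a * (𝟙 k * g (n ∸ k))) ≈⟨ Σ-distribˡ n _ _ ⟨
    a * (𝟙 ⋆ g) n                       ≈⟨ *-congˡ (⋆-identityˡ g n) ⟩
    a * g n                             ∎

  const-^ : ∀ a r → const a ^ r ≋ const (pow F a r)
  const-^ a zero    n = sym (*-identityˡ _)
  const-^ a (suc r) n =
    trans (const-⋆ a (const a ^ r) n) (trans (*-congˡ (const-^ a r n)) (sym (*-assoc _ _ _)))

  ^-coeff : ∀ f l m → (f ^ l) m ≈ sumList F (map (prodList F ∘ map f) (comps F l m))
  ^-coeff f zero    zero    = sym (+-identityʳ _)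
  ^-coeff f zero    (suc m) = refl
  ^-coeff f (suc l) m = begin
    Σ[ i ≤ m ] (f i * (f ^ l) (m ∸ i))
      ≈⟨ Σ-cong m (λ i → *-congˡ (^-coeff f l (m ∸ i))) ⟩
    Σ[ i ≤ m ] (f i * sumList F (map P (comps F l (m ∸ i))))
      ≈⟨ Σ-cong m (λ i → sumList-distribˡ (f i) P (comps F l (m ∸ i))) ⟩
    Σ[ i ≤ m ] sumList F (map (P ∘ (i ∷_)) (comps F l (m ∸ i)))
      ≈⟨ Σ-cong m (λ i → reflexive (≡.cong (sumList F) (List.map-∘ (comps F l (m ∸ i))))) ⟩
    Σ[ i ≤ m ] sumList F (map P (map (i ∷_) (comps F l (m ∸ i))))
      ≈⟨ sumList-applyUpTo m (λ i → i) _ ⟨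
    sumList F (map (λ i → sumList F (map P (map (i ∷_) (comps F l (m ∸ i))))) (upTo (suc m)))
      ≈⟨ sumList-concatMap P (λ i → map (i ∷_) (comps F l (m ∸ i))) (upTo (suc m)) ⟨
    sumList F (map P (comps F (suc l) m)) ∎
    where
      P : List ℕ → Carrier
      P = prodList F ∘ map f

  sum-coeff : ∀ r (g : ℕ → FormalSeries) m → sum {suc r} (g ∘ toℕ) m ≈ Σ[ l ≤ r ] g l m
  sum-coeff zero    g m = +-identityʳ _
  sum-coeff (suc r) g m = trans (+-congˡ (sum-coeff r (g ∘ suc) m)) (sym (Σ-suc r _))

  ×-coeff : ∀ k g m → (k × g) m ≈ fromℕ F k * g m
  ×-coeff zero    g m = sym (zeroˡ _)
  ×-coeff (suc k) g m = trans (+-cong (sym (*-identityˡ _)) (×-coeff k g m)) (sym (distribʳ _ _ _))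

  binomial-coeff : ∀ f a r m →
    ((f ⊕ const a) ^ r) m
      ≈ Σ[ l ≤ r ] sumList F (map (λ is → fromℕ F (r C l) * (pow F a (r ∸ l) * prodList F (map f is)))
                                  (comps F l m))
  binomial-coeff f a r m = begin
    ((f ⊕ const a) ^ r) m
      ≈⟨ Binomial.theorem r f (const a) m ⟩
    sum {suc r} (λ k → ((r C toℕ k) × (f ^ toℕ k ⋆ const a ^ (r ∸ toℕ k)))) m
      ≈⟨ sum-coeff r (λ l → (r C l) × (f ^ l ⋆ const a ^ (r ∸ l))) m ⟩
    Σ[ l ≤ r ] ((r C l) × (f ^ l ⋆ const a ^ (r ∸ l))) m
      ≈⟨ Σ-cong r (λ l → trans (×-coeff (r C l) _ m) (*-congˡ (term l))) ⟩
    Σ[ l ≤ r ] (fromℕ F (r C l) * sumList F (map (λ is → pow F a (r ∸ l) * prodList F (map f is))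
                                                  (comps F l m)))
      ≈⟨ Σ-cong r (λ l → sumList-distribˡ (fromℕ F (r C l)) _ (comps F l m)) ⟩
    Σ[ l ≤ r ] sumList F (map (λ is → fromℕ F (r C l) * (pow F a (r ∸ l) * prodList F (map f is)))
                              (comps F l m)) ∎
    where
      module Binomial = Algebra.Properties.CommutativeSemiring.Binomial seriesSemiring
      term : ∀ l → (f ^ l ⋆ const a ^ (r ∸ l)) m
                     ≈ sumList F (map (λ is → pow F a (r ∸ l) * prodList F (map f is)) (comps F l m))
      term l = begin
        (f ^ l ⋆ const a ^ (r ∸ l)) m           ≈⟨ ⋆-comm (f ^ l) _ m ⟩
        (const a ^ (r ∸ l) ⋆ f ^ l) m           ≈⟨ ⋆-congʳ (f ^ l) (const-^ a (r ∸ l)) m ⟩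
        (const (pow F a (r ∸ l)) ⋆ f ^ l) m     ≈⟨ const-⋆ _ (f ^ l) m ⟩
        pow F a (r ∸ l) * (f ^ l) m             ≈⟨ *-congˡ (^-coeff f l m) ⟩
        pow F a (r ∸ l) * sumList F (map (prodList F ∘ map f) (comps F l m))
                                                ≈⟨ sumList-distribˡ _ _ (comps F l m) ⟩
        sumList F (map (λ is → pow F a (r ∸ l) * prodList F (map f is)) (comps F l m)) ∎

module FieldPowers {c ℓ} (F : Field c ℓ) where
  open Field F
  open import Algebra.Solver.CommutativeMonoid *-commutativeMonoid using (solve; _⊜_; _⊕_)

  pow-inverse : ∀ {a b} → a * b ≈ 1# → ∀ r → pow F a r * pow F b r ≈ 1#
  pow-inverse ab≈1 zero    = *-identityˡ 1#
  pow-inverse {a} {b} ab≈1 (suc r) = begin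
    (a * pow F a r) * (b * pow F b r)
      ≈⟨ solve 4 (λ a b u v → (a ⊕ u) ⊕ (b ⊕ v) ⊜ (a ⊕ b) ⊕ (u ⊕ v)) refl
               a b (pow F a r) (pow F b r) ⟩
    (a * b) * (pow F a r * pow F b r)
      ≈⟨ *-cong ab≈1 (pow-inverse ab≈1 r) ⟩
    1# * 1#
      ≈⟨ *-identityˡ 1# ⟩
    1# ∎
    where open import Relation.Binary.Reasoning.Setoid setoid

module QCalculus {c ℓ} (F : Field c ℓ) (q : Field.Carrier F) (q≉1 : ¬ (Field._≈_ F q (Field.1# F)))
    (qnz : (n : ℕ) → ¬ (Field._≈_ F (qint F q q≉1 (suc n)) (Field.0# F))) where
  open Field F
  open PowerSeries F
  open import Relation.Binary.Reasoning.Setoid setoid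
  open import Algebra.Solver.CommutativeMonoid *-commutativeMonoid using (solve; _⊜_) renaming (_⊕_ to _·_)

  [_]! : ℕ → Carrier
  [_]! = qfact F q q≉1

  [_]!⁻¹ : ℕ → Carrier
  [_]!⁻¹ = qfactInv F q q≉1 qnz

  qfact-inverse : ∀ n → [ n ]! * [ n ]!⁻¹ ≈ 1#
  qfact-inverse zero    = *-identityˡ 1#
  qfact-inverse (suc n) = begin
    ([n+1] * [ n ]!) * (inv [n+1] (qnz n) * [ n ]!⁻¹)
      ≈⟨ solve 4 (λ a b c d → (a · b) · (c · d) ⊜ (a · c) · (b · d)) refl _ _ _ _ ⟩
    ([n+1] * inv [n+1] (qnz n)) * ([ n ]! * [ n ]!⁻¹)
      ≈⟨ *-cong (inv-law [n+1] (qnz n)) (qfact-inverse n) ⟩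
    1# * 1#
      ≈⟨ *-identityˡ 1# ⟩
    1# ∎
    where [n+1] = qint F q q≉1 (suc n)

  cancel-qfact : ∀ n {y} → ([ n ]! * [ n ]!⁻¹) * y ≈ y
  cancel-qfact n = trans (*-congʳ (qfact-inverse n)) (*-identityˡ _)

  -- No hypothesis m + k ≤ n is needed: each [i]! cancels against its own inverse, even at a
  -- truncated index i.
  qbinom-telescope : ∀ n m k y →
    [ m ]! * (qbinom F q q≉1 qnz (m +ℕ k) m * (qbinom F q q≉1 qnz n (m +ℕ k) * ([ n ∸ m ∸ k ]! * y)))
      ≈ [ n ]! * ([ k ]!⁻¹ * y)
  qbinom-telescope n m k y = begin
    [ m ]! * ((([ m +ℕ k ]! * [ m ]!⁻¹) * [ m +ℕ k ∸ m ]!⁻¹)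
               * ((([ n ]! * [ m +ℕ k ]!⁻¹) * [ n ∸ (m +ℕ k) ]!⁻¹) * ([ j ]! * y)))
      ≈⟨ *-congˡ (*-cong (*-congˡ (reflexive (≡.cong [_]!⁻¹ (ℕ.m+n∸m≡n m k))))
                         (*-congʳ (*-congˡ (reflexive (≡.cong [_]!⁻¹
                                                          (≡.sym (ℕ.∸-+-assoc n m k))))))) ⟩
    [ m ]! * ((([ m +ℕ k ]! * [ m ]!⁻¹) * [ k ]!⁻¹)
               * ((([ n ]! * [ m +ℕ k ]!⁻¹) * [ j ]!⁻¹) * ([ j ]! * y)))
      ≈⟨ solve 9 (λ m! m+k! m!⁻¹ k!⁻¹ n! m+k!⁻¹ j!⁻¹ j! y′ →
             m! · (((m+k! · m!⁻¹) · k!⁻¹) · (((n! · m+k!⁻¹) · j!⁻¹) · (j! · y′)))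
           ⊜ (m! · m!⁻¹) · ((m+k! · m+k!⁻¹) · ((j! · j!⁻¹) · (n! · (k!⁻¹ · y′))))) refl
           [ m ]! [ m +ℕ k ]! [ m ]!⁻¹ [ k ]!⁻¹ [ n ]! [ m +ℕ k ]!⁻¹ [ j ]!⁻¹ [ j ]! y ⟩
    ([ m ]! * [ m ]!⁻¹)
      * (([ m +ℕ k ]! * [ m +ℕ k ]!⁻¹) * (([ j ]! * [ j ]!⁻¹) * ([ n ]! * ([ k ]!⁻¹ * y))))
      ≈⟨ trans (cancel-qfact m) (trans (cancel-qfact (m +ℕ k)) (cancel-qfact j)) ⟩
    [ n ]! * ([ k ]!⁻¹ * y) ∎
    where j = n ∸ m ∸ k

  oneSeries≋𝟙 : oneSeries F q q≉1 qnz ≋ 𝟙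
  oneSeries≋𝟙 zero    = refl
  oneSeries≋𝟙 (suc n) = refl

  seriesPow≋^ : ∀ f s → seriesPow F q q≉1 qnz f s ≋ f ^ s
  seriesPow≋^ f zero    = oneSeries≋𝟙
  seriesPow≋^ f (suc s) = ⋆-cong (λ _ → refl) (seriesPow≋^ f s)

  eqSeries-0 : eqSeries F q q≉1 qnz 0# ≋ 𝟙
  eqSeries-0 zero    = *-identityˡ 1#
  eqSeries-0 (suc n) = trans (*-congʳ (zeroˡ _)) (zeroˡ _)

module Kernel {c ℓ} (F : Field c ℓ) (q : Field.Carrier F) (q≉1 : ¬ (Field._≈_ F q (Field.1# F)))
    (qnz : (n : ℕ) → ¬ (Field._≈_ F (qint F q q≉1 (suc n)) (Field.0# F)))
    (la : Field.Carrier F) (la≉1 : ¬ (Field._≈_ F la (Field.1# F))) where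
  open Field F
  open FiniteSums F
  open PowerSeries F
  open QCalculus F q q≉1 qnz
  open import Relation.Binary.Reasoning.Setoid setoid
  open import Algebra.Properties.Ring ring using (-‿distribʳ-*)

  K : FormalSeries
  K = kernel F q q≉1 qnz la la≉1

  B : FormalSeries
  B = invSeries F q q≉1 qnz la la≉1

  D : FormalSeries
  D = [_]!⁻¹ ⊕ const (- la)

  [1-λ]⁻¹ : Carrier
  [1-λ]⁻¹ = c₀ F q q≉1 qnz la la≉1

  Hλ : ℕ → Carrier → ℕ → Carrier
  Hλ = H F q q≉1 qnz la la≉1

  invCoeffs≡ : ∀ m → invCoeffs F q q≉1 qnz la la≉1 m ≡ map B (downFrom (suc m))
  invCoeffs≡ zero    = ≡.refl
  invCoeffs≡ (suc m) = ≡.cong (B (suc m) ∷_) (invCoeffs≡ m)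

  B-suc : ∀ m → B (suc m) ≈ - ([1-λ]⁻¹ * Σ[ j ≤ m ] ([ suc j ]!⁻¹ * B (m ∸ j)))
  B-suc m = -‿cong (*-congˡ (begin
    sumList F (zipWith _*_ (map (λ j → [ suc j ]!⁻¹) (upTo (suc m))) (invCoeffs F q q≉1 qnz la la≉1 m))
      ≡⟨ ≡.cong₂ (λ u v → sumList F (zipWith _*_ u v))
                 (List.map-upTo (λ j → [ suc j ]!⁻¹) (suc m)) (invCoeffs≡ m) ⟩
    sumList F (zipWith _*_ (applyUpTo (λ j → [ suc j ]!⁻¹) (suc m)) (map B (downFrom (suc m))))
      ≈⟨ sumList-zipWith-downFrom m _ B ⟩
    Σ[ j ≤ m ] ([ suc j ]!⁻¹ * B (m ∸ j)) ∎))

  D⋆B≋𝟙 : D ⋆ B ≋ 𝟙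
  D⋆B≋𝟙 zero = trans (*-congʳ (+-congˡ (*-identityʳ (- la)))) (inv-law (1# - la) _)
  D⋆B≋𝟙 (suc m) = begin
    Σ[ k ≤ suc m ] (D k * B (suc m ∸ k))
      ≈⟨ Σ-suc m _ ⟩
    D 0 * B (suc m) + Σ[ k ≤ m ] (D (suc k) * B (m ∸ k))
      ≈⟨ +-cong leading (Σ-cong m (λ k → *-congʳ (trans (+-congˡ (zeroʳ (- la))) (+-identityʳ _)))) ⟩
    - L + L
      ≈⟨ -‿inverseˡ L ⟩
    0# ∎
    where
      L = Σ[ j ≤ m ] ([ suc j ]!⁻¹ * B (m ∸ j))
      leading : D 0 * B (suc m) ≈ - L
      leading = begin
        (1# + - la * 1#) * B (suc m)
          ≈⟨ *-cong (+-congˡ (*-identityʳ (- la))) (B-suc m) ⟩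
        (1# - la) * - ([1-λ]⁻¹ * L)
          ≈⟨ -‿distribʳ-* (1# - la) ([1-λ]⁻¹ * L) ⟨
        - ((1# - la) * ([1-λ]⁻¹ * L))
          ≈⟨ -‿cong (trans (sym (*-assoc _ _ _)) (trans (*-congʳ (inv-law (1# - la) _)) (*-identityˡ L))) ⟩
        - L ∎

  K⋆D≋const : K ⋆ D ≋ const (1# - la)
  K⋆D≋const n = begin
    Σ[ k ≤ n ] (((1# - la) * B k) * D (n ∸ k)) ≈⟨ Σ-cong n (λ _ → *-assoc _ _ _) ⟩
    Σ[ k ≤ n ] ((1# - la) * (B k * D (n ∸ k))) ≈⟨ Σ-distribˡ n _ _ ⟨
    (1# - la) * (B ⋆ D) n                      ≈⟨ *-congˡ (trans (⋆-comm B D n) (D⋆B≋𝟙 n)) ⟩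
    const (1# - la) n                          ∎

  H-coeff : ∀ s y n → Hλ s y n ≈ [ n ]! * (K ^ s ⋆ eqSeries F q q≉1 qnz y) n
  H-coeff s y n = *-congˡ (⋆-congʳ (eqSeries F q q≉1 qnz y) (seriesPow≋^ K s) n)

  H₁-coeff : ∀ y n → Hλ 1 y n ≈ [ n ]! * (K ⋆ eqSeries F q q≉1 qnz y) n
  H₁-coeff y n = trans (H-coeff 1 y n) (*-congˡ (⋆-congʳ (eqSeries F q q≉1 qnz y) (⋆-identityʳ K) n))

  H-at-0 : ∀ j → Hλ 1 0# j ≈ [ j ]! * K j
  H-at-0 j =
    trans (H₁-coeff 0# j) (*-congˡ (trans (⋆-cong (λ _ → refl) eqSeries-0 j) (⋆-identityʳ K j)))

module Expansion {c ℓ} (F : Field c ℓ) (q : Field.Carrier F) (q≉1 : ¬ (Field._≈_ F q (Field.1# F)))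
    (qnz : (n : ℕ) → ¬ (Field._≈_ F (qint F q q≉1 (suc n)) (Field.0# F)))
    (la : Field.Carrier F) (la≉1 : ¬ (Field._≈_ F la (Field.1# F))) (x : Field.Carrier F) (n r : ℕ) where
  open Field F
  open FiniteSums F
  open PowerSeries F
  open QCalculus F q q≉1 qnz
  open Kernel F q q≉1 qnz la la≉1
  open import Relation.Binary.Reasoning.Setoid setoid
  open import Algebra.Solver.CommutativeMonoid *-commutativeMonoid
    using (solve; _⊜_; id) renaming (_⊕_ to _·_)

  braceTerm : ℕ → ℕ → Carrier
  braceTerm k m = Σ[ l ≤ r ] sumList F (map (λ is → prodList F
    (fromℕ F (r C l) ∷ pow F (- la) (r ∸ l) ∷ qmultinom F q q≉1 qnz m is
     ∷ qbinom F q q≉1 qnz (m +ℕ k) m ∷ qbinom F q q≉1 qnz n (m +ℕ k)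
     ∷ Hλ 1 0# (n ∸ m ∸ k) ∷ [])) (comps F l m))

  braceTerm-coeff : ∀ k m → braceTerm k m ≈ ([ n ]! * [ k ]!⁻¹) * ((D ^ r) m * K (n ∸ k ∸ m))
  braceTerm-coeff k m = begin
    braceTerm k m
      ≈⟨ Σ-cong r (λ l → sumList-cong (comps F l m) (summand l)) ⟩
    Σ[ l ≤ r ] sumList F (map (λ is → binomialTerm l is * w) (comps F l m))
      ≈⟨ Σ-cong r (λ l → sumList-distribʳ w (binomialTerm l) (comps F l m)) ⟨
    Σ[ l ≤ r ] (sumList F (map (binomialTerm l) (comps F l m)) * w)
      ≈⟨ Σ-distribʳ r w _ ⟨
    Σ[ l ≤ r ] sumList F (map (binomialTerm l) (comps F l m)) * w
      ≈⟨ *-congʳ (binomial-coeff [_]!⁻¹ (- la) r m) ⟨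
    (D ^ r) m * ([ n ]! * ([ k ]!⁻¹ * K j))
      ≈⟨ solve 4 (λ d n! k!⁻¹ κ → d · (n! · (k!⁻¹ · κ)) ⊜ (n! · k!⁻¹) · (d · κ)) refl
               ((D ^ r) m) [ n ]! [ k ]!⁻¹ (K j) ⟩
    ([ n ]! * [ k ]!⁻¹) * ((D ^ r) m * K j)
      ≡⟨ ≡.cong (λ i → ([ n ]! * [ k ]!⁻¹) * ((D ^ r) m * K i)) ∸-swap ⟩
    ([ n ]! * [ k ]!⁻¹) * ((D ^ r) m * K (n ∸ k ∸ m)) ∎
    where
      j = n ∸ m ∸ k
      w = [ n ]! * ([ k ]!⁻¹ * K j)

      binomialTerm : ℕ → List ℕ → Carrier
      binomialTerm l is = fromℕ F (r C l) * (pow F (- la) (r ∸ l) * prodList F (map [_]!⁻¹ is))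

      summand : ∀ l is → prodList F (fromℕ F (r C l) ∷ pow F (- la) (r ∸ l)
                                     ∷ qmultinom F q q≉1 qnz m is
                                     ∷ qbinom F q q≉1 qnz (m +ℕ k) m ∷ qbinom F q q≉1 qnz n (m +ℕ k)
                                     ∷ Hλ 1 0# j ∷ [])
                         ≈ binomialTerm l is * w
      summand l is = trans
        (solve 7 (λ a p m! π b₁ b₂ h → a · (p · ((m! · π) · (b₁ · (b₂ · (h · id)))))
                                      ⊜ (a · (p · π)) · (m! · (b₁ · (b₂ · h)))) refl _ _ _ _ _ _ _)
        (*-congˡ (trans (*-congˡ (*-congˡ (*-congˡ (H-at-0 j)))) (qbinom-telescope n m k (K j))))

      ∸-swap : n ∸ m ∸ k ≡ n ∸ k ∸ m
      ∸-swap = ≡.trans (ℕ.∸-+-assoc n m k)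
                 (≡.trans (≡.cong (n ∸_) (ℕ.+-comm m k)) (≡.sym (ℕ.∸-+-assoc n k m)))

  Eₓ : FormalSeries
  Eₓ = eqSeries F q q≉1 qnz x

  KʳEₓ : FormalSeries
  KʳEₓ = K ^ r ⋆ Eₓ

  DʳK : FormalSeries
  DʳK = D ^ r ⋆ K

  outer-summand : ∀ k → Σ[ m ≤ n ∸ k ] braceTerm k m * Hλ r x k ≈ [ n ]! * (KʳEₓ k * DʳK (n ∸ k))
  outer-summand k = begin
    Σ[ m ≤ n ∸ k ] braceTerm k m * Hλ r x k
      ≈⟨ *-cong (Σ-cong (n ∸ k) (braceTerm-coeff k)) (H-coeff r x k) ⟩
    Σ[ m ≤ n ∸ k ] (([ n ]! * [ k ]!⁻¹) * ((D ^ r) m * K (n ∸ k ∸ m))) * ([ k ]! * KʳEₓ k)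
      ≈⟨ *-congʳ (Σ-distribˡ (n ∸ k) _ _) ⟨
    (([ n ]! * [ k ]!⁻¹) * DʳK (n ∸ k)) * ([ k ]! * KʳEₓ k)
      ≈⟨ solve 5 (λ n! k!⁻¹ ξ k! γ → ((n! · k!⁻¹) · ξ) · (k! · γ) ⊜ (k! · k!⁻¹) · (n! · (γ · ξ)))
               refl
               [ n ]! [ k ]!⁻¹ (DʳK (n ∸ k)) [ k ]! (KʳEₓ k) ⟩
    ([ k ]! * [ k ]!⁻¹) * ([ n ]! * (KʳEₓ k * DʳK (n ∸ k)))
      ≈⟨ cancel-qfact k ⟩
    [ n ]! * (KʳEₓ k * DʳK (n ∸ k)) ∎

  KʳEₓ⋆DʳK : KʳEₓ ⋆ DʳK ≋ const (pow F (1# - la) r) ⋆ (K ⋆ Eₓ)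
  KʳEₓ⋆DʳK i = begin
    ((K ^ r ⋆ Eₓ) ⋆ (D ^ r ⋆ K)) i
      ≈⟨ ⋆-interchange (K ^ r) Eₓ (D ^ r) K i ⟩
    ((K ^ r ⋆ D ^ r) ⋆ (Eₓ ⋆ K)) i
      ≈⟨ ⋆-cong (⋆-comm (K ^ r) (D ^ r)) (⋆-comm Eₓ K) i ⟩
    ((D ^ r ⋆ K ^ r) ⋆ (K ⋆ Eₓ)) i
      ≈⟨ ⋆-congʳ (K ⋆ Eₓ) (^-distrib-* D K r) i ⟨
    ((D ⋆ K) ^ r ⋆ (K ⋆ Eₓ)) i
      ≈⟨ ⋆-congʳ (K ⋆ Eₓ) (^-congˡ r (λ j → trans (⋆-comm D K j) (K⋆D≋const j))) i ⟩
    (const (1# - la) ^ r ⋆ (K ⋆ Eₓ)) i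
      ≈⟨ ⋆-congʳ (K ⋆ Eₓ) (const-^ (1# - la) r) i ⟩
    (const (pow F (1# - la) r) ⋆ (K ⋆ Eₓ)) i ∎

open import Data.Nat using (_+_)

theorem2p10 : ∀ {c ℓ} (F : Field c ℓ)
    (q : Field.Carrier F) (q≉1 : ¬ (Field._≈_ F q (Field.1# F)))
    (qnz : (n : ℕ) → ¬ (Field._≈_ F (qint F q q≉1 (suc n)) (Field.0# F)))
    (la : Field.Carrier F) (la≉1 : ¬ (Field._≈_ F la (Field.1# F)))
    (x : Field.Carrier F) (n r : ℕ) →
    Field._≈_ F
      (H F q q≉1 qnz la la≉1 1 x n)
      (Field._*_ F
        (pow F (Field.inv F (Field._-_ F (Field.1# F) la) (1-≉0 F la la≉1)) r)
        (sumTo F n (λ k →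
          Field._*_ F
            (sumTo F (n ∸ k) (λ m →
              sumTo F r (λ l →
                sumList F (map (λ is →
                    prodList F
                      (fromℕ F (r C l)
                       ∷ pow F (Field.-_ F la) (r ∸ l)
                       ∷ qmultinom F q q≉1 qnz m is
                       ∷ qbinom F q q≉1 qnz (m + k) m
                       ∷ qbinom F q q≉1 qnz n (m + k)
                       ∷ H F q q≉1 qnz la la≉1 1 (Field.0# F) (n ∸ m ∸ k)
                       ∷ []))
                  (comps F l m)))))
            (H F q q≉1 qnz la la≉1 r x k))))
theorem2p10 F q q≉1 qnz la la≉1 x n r = sym (begin
  pow F [1-λ]⁻¹ r * Σ[ k ≤ n ] (Σ[ m ≤ n ∸ k ] braceTerm k m * Hλ r x k)
    ≈⟨ *-congˡ (Σ-cong n outer-summand) ⟩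
  pow F [1-λ]⁻¹ r * Σ[ k ≤ n ] ([ n ]! * (KʳEₓ k * DʳK (n ∸ k)))
    ≈⟨ *-congˡ (Σ-distribˡ n [ n ]! _) ⟨
  pow F [1-λ]⁻¹ r * ([ n ]! * (KʳEₓ ⋆ DʳK) n)
    ≈⟨ *-congˡ (*-congˡ (trans (KʳEₓ⋆DʳK n) (const-⋆ _ (K ⋆ Eₓ) n))) ⟩
  pow F [1-λ]⁻¹ r * ([ n ]! * (pow F (1# - la) r * (K ⋆ Eₓ) n))
    ≈⟨ solve 4 (λ c n! p κ → c · (n! · (p · κ)) ⊜ (p · c) · (n! · κ)) refl _ _ _ _ ⟩
  (pow F (1# - la) r * pow F [1-λ]⁻¹ r) * ([ n ]! * (K ⋆ Eₓ) n)
    ≈⟨ trans (*-congʳ (pow-inverse (inv-law (1# - la) _) r)) (*-identityˡ _) ⟩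
  [ n ]! * (K ⋆ Eₓ) n
    ≈⟨ H₁-coeff x n ⟨
  Hλ 1 x n ∎)
  where
    open Field F
    open FiniteSums F
    open PowerSeries F
    open FieldPowers F
    open QCalculus F q q≉1 qnz
    open Kernel F q q≉1 qnz la la≉1
    open Expansion F q q≉1 qnz la la≉1 x n r
    open import Relation.Binary.Reasoning.Setoid setoid
    open import Algebra.Solver.CommutativeMonoid *-commutativeMonoid using (solve; _⊜_) renaming (_⊕_ to _·_)
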